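{- Let $G$ be a connected graph with $n\ge 3$ vertices. If $G$ has a vertex of degree $1$ (a leaf), then $G$ is not direct-topfull.
   Context: Graphs are finite, simple and undirected; $d_G$ denotes shortest-path distance. For an integer $\ell\ge 0$, an $\ell$-track on $G$ is a surjective function $f:\{0,\dots,\ell\}\to V(G)$ with $f(i)f(i+1)\in E(G)$ for all $0\le i<\ell$. For $f,g:\{0,\dots,\ell\}\to V(G)$, $m_G(f,g)=\min_i d_G(f(i),g(i))$; for a family $F=\{f_1,\dots,f_p\}$ with $p\ge2$, $m_G(F)=\min_{i\ne j}m_G(f_i,f_j)$. An $\ell$-tour is a family of $\ell$-tracks. The direct $1$-capacity $\mathrm{cap}^\times_1(G)$ is the maximum $c$ such that there is an $\ell$-tour $F=\{f_1,\dots,f_c\}$ (some $\ell$) with $m_G(F)=1$. A connected graph on $n$ vertices is direct-topfull if $\mathrm{cap}^\times_1(G)=n$. -}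

module Defs where

open import Data.Nat using (ℕ; zero; suc; _≤_; _+_)
open import Data.Fin using (Fin)
open import Data.Bool using (Bool; true; false; if_then_else_)
open import Data.List using (map; allFin)
open import Data.Nat.ListAction using (sum)
open import Data.Product using (Σ; ∃; _×_; _,_)
open import Relation.Binary.PropositionalEquality using (_≡_)
open import Relation.Nullary using (¬_)

record Graph (n : ℕ) : Set where
  field
    adj   : Fin n → Fin n → Bool
    sym   : ∀ u v → adj u v ≡ adj v u
    irrefl : ∀ v → adj v v ≡ false
open Graph public

Edge : ∀ {n} → Graph n → Fin n → Fin n → Set
Edge G u v = adj G u v ≡ true

degree : ∀ {n} → Graph n → Fin n → ℕ
degree {n} G v = sum (map (λ w → if adj G v w then 1 else 0) (allFin n))

data Walk {n} (G : Graph n) : Fin n → Fin n → ℕ → Set where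
  here : ∀ {u} → Walk G u u 0
  step : ∀ {u w v k} → Edge G u w → Walk G w v k → Walk G u v (suc k)

Connected : ∀ {n} → Graph n → Set
Connected G = ∀ u v → ∃ λ k → Walk G u v k

Dist : ∀ {n} → Graph n → Fin n → Fin n → ℕ → Set
Dist G u v d = Walk G u v d × (∀ k → Walk G u v k → d ≤ k)

Surjective : ∀ {A : Set} {B : Set} → (A → B) → Set
Surjective {A} {B} f = ∀ b → ∃ λ (a : A) → f a ≡ b

record Track {n} (G : Graph n) (ℓ : ℕ) : Set where
  field
    fn   : Fin (suc ℓ) → Fin n
    surj : Surjective fn
    adjacent : ∀ (i : Fin ℓ) → Edge G (fn (Data.Fin.inject₁ i)) (fn (Data.Fin.suc i))
open Track public

-- m_G(F) = 1 for the family F = {f_i | i : Fin c}, i.e. the minimum over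
-- pairs i ≠ j and times t of d_G(f_i t, f_j t) equals 1:
-- every such distance is ≥ 1, and some such distance equals 1.
MinDistOne : ∀ {n ℓ c} (G : Graph n) → (Fin c → Track G ℓ) → Set
MinDistOne {n} {ℓ} {c} G F =
  (∀ (i j : Fin c) → ¬ i ≡ j → ∀ (t : Fin (suc ℓ)) (d : ℕ) →
     Dist G (fn (F i) t) (fn (F j) t) d → 1 ≤ d)
  × (Σ (Fin c) λ i → Σ (Fin c) λ j → ¬ i ≡ j × Σ (Fin (suc ℓ)) λ t →
     Dist G (fn (F i) t) (fn (F j) t) 1)

-- there is an ℓ-tour of c tracks (c ≥ 2, as m_G(F) needs p ≥ 2) with m_G(F) = 1
Achievable1 : ∀ {n} → Graph n → ℕ → Set
Achievable1 G c = 2 ≤ c × Σ ℕ λ ℓ → Σ (Fin c → Track G ℓ) λ F → MinDistOne G F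

IsDirectCap1 : ∀ {n} → Graph n → ℕ → Set
IsDirectCap1 G c = Achievable1 G c × (∀ c' → Achievable1 G c' → c' ≤ c)

DirectTopfull : ∀ {n} → Graph n → Set
DirectTopfull {n} G = Connected G × IsDirectCap1 G n

{-# OPTIONS --safe #-}
-- If v is a leaf with neighbour u, a track standing on v must step to u, and a track arriving
-- at v must come from u.  When n collision-free tracks share n vertices every vertex is
-- occupied at all times, so the tracks on u and v simply trade places at every step: the two
-- tracks that start on {u, v} are the only ones that ever visit v, and with n ≥ 3 some third
-- track misses v, contradicting surjectivity.
module Submission where

open import Defs
open import Data.Nat using (ℕ; _≤_; zero; suc; z≤n; s≤s)
open import Data.Nat.Properties using (n<1+n; suc-injective)
open import Data.Nat.ListAction using (sum)
open import Data.Fin using (Fin; zero; suc; inject₁; punchOut)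
open import Data.Fin.Properties using (_≟_; any?; punchOut-injective; <⇒notInjective)
open import Data.Fin.Induction using (<-weakInduction)
open import Data.Bool using (Bool; true; false; if_then_else_)
open import Data.List using (tabulate)
open import Data.List.Properties using (map-tabulate)
open import Data.Product using (∃; ∃₂; _×_; _,_)
open import Data.Sum using (_⊎_; inj₁; inj₂; [_,_])
open import Data.Empty using (⊥-elim)
open import Function using (id; _∘_)
open import Function.Definitions using (Injective)
open import Relation.Binary.PropositionalEquality
  using (_≡_; _≢_; refl; trans; cong; subst) renaming (sym to ≡-sym)
open import Relation.Nullary using (¬_; yes; no)

sum-indicator≡0 : ∀ {n} (g : Fin n → Bool) →
  sum (tabulate (λ w → if g w then 1 else 0)) ≡ 0 → ∀ w → g w ≡ false
sum-indicator≡0 {suc n} g s w with g zero in eq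
sum-indicator≡0 g s zero    | false = eq
sum-indicator≡0 g s (suc w) | false = sum-indicator≡0 (λ x → g (suc x)) s w

sum-indicator≡1 : ∀ {n} (g : Fin n → Bool) →
  sum (tabulate (λ w → if g w then 1 else 0)) ≡ 1 →
  ∃ λ u → g u ≡ true × (∀ w → g w ≡ true → w ≡ u)
sum-indicator≡1 {zero} g ()
sum-indicator≡1 {suc n} g s with g zero in eq
... | true = zero , eq , unique
  where
  unique : ∀ w → g w ≡ true → w ≡ zero
  unique zero    _  = refl
  unique (suc w) gw
    with () ← trans (≡-sym gw) (sum-indicator≡0 (λ x → g (suc x)) (suc-injective s) w)
... | false with u , gu , unique ← sum-indicator≡1 (λ x → g (suc x)) s =
  suc u , gu , unique′
  where
  unique′ : ∀ w → g w ≡ true → w ≡ suc u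
  unique′ zero    gw with () ← trans (≡-sym gw) eq
  unique′ (suc w) gw = cong suc (unique w gw)

degree≡1⇒uniqueNeighbour : ∀ {n} (G : Graph n) v → degree G v ≡ 1 →
  ∃ λ u → Edge G v u × (∀ w → Edge G v w → w ≡ u)
degree≡1⇒uniqueNeighbour G v deg = sum-indicator≡1 (adj G v)
  (subst (λ xs → sum xs ≡ 1) (map-tabulate id (λ w → if adj G v w then 1 else 0)) deg)

injective⇒surjective : ∀ {n} {f : Fin n → Fin n} → Injective _≡_ _≡_ f →
  ∀ x → ∃ λ i → f i ≡ x
injective⇒surjective {zero}  _     ()
injective⇒surjective {suc n} {f} f-inj x with any? (λ i → f i ≟ x)
... | yes hit = hit
... | no miss = ⊥-elim (<⇒notInjective (n<1+n n) avoid-inj)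
  where
  avoid : Fin (suc n) → Fin n
  avoid i = punchOut {i = x} λ x≡fi → miss (i , ≡-sym x≡fi)
  avoid-inj : Injective _≡_ _≡_ avoid
  avoid-inj eq = f-inj (punchOut-injective {i = x} _ _ eq)

CollisionFree : ∀ {n ℓ c} (G : Graph n) → (Fin c → Track G ℓ) → Set
CollisionFree G F = ∀ t → Injective _≡_ _≡_ (λ i → fn (F i) t)

minDistOne⇒collisionFree : ∀ {n ℓ c} (G : Graph n) (F : Fin c → Track G ℓ) →
  MinDistOne G F → CollisionFree G F
minDistOne⇒collisionFree G F (separated , _) t {i} {j} eq with i ≟ j
... | yes i≡j = i≡j
... | no  i≢j with () ← separated i j i≢j t 0
                          (subst (λ x → Dist G (fn (F i) t) x 0) eq (here , λ _ _ → z≤n))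

module _ {n ℓ} (G : Graph n) (F : Fin n → Track G ℓ) (collisionFree : CollisionFree G F)
         {v u : Fin n} (onlyNeighbour : ∀ w → Edge G v w → w ≡ u) where

  private
    pos : Fin n → Fin (suc ℓ) → Fin n
    pos i = fn (F i)

    occupied : ∀ t x → ∃ λ i → pos i t ≡ x
    occupied t = injective⇒surjective (collisionFree t)

    leaving : ∀ {p} i → pos p (inject₁ i) ≡ v → pos p (suc i) ≡ u
    leaving {p} i pv =
      onlyNeighbour _ (subst (λ y → Edge G y (pos p (suc i))) pv (adjacent (F p) i))

    entering : ∀ {p} i → pos p (suc i) ≡ v → pos p (inject₁ i) ≡ u
    entering {p} i pv = onlyNeighbour _
      (trans (sym G v _) (subst (Edge G (pos p (inject₁ i))) pv (adjacent (F p) i)))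

    OnLeafAndNeighbour : Fin n → Fin n → Fin (suc ℓ) → Set
    OnLeafAndNeighbour p q t = pos p t ≡ v × pos q t ≡ u

    trade : ∀ {p q} i → OnLeafAndNeighbour p q (inject₁ i) → OnLeafAndNeighbour q p (suc i)
    trade {p} {q} i (pv , qu) with k , kv ← occupied (suc i) v =
      subst (λ r → pos r (suc i) ≡ v) k≡q kv , leaving i pv
      where
      k≡q : k ≡ q
      k≡q = collisionFree (inject₁ i) (trans (entering i kv) (≡-sym qu))

  leafVisitedByTwoTracks : ∃₂ λ a b → ∀ c t → fn (F c) t ≡ v → c ≡ a ⊎ c ≡ b
  leafVisitedByTwoTracks with a , av ← occupied zero v | b , bu ← occupied zero u =
    a , b , onlyPair
    where
    Pair : Fin (suc ℓ) → Set
    Pair t = OnLeafAndNeighbour a b t ⊎ OnLeafAndNeighbour b a t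

    pair : ∀ t → Pair t
    pair = <-weakInduction Pair (inj₁ (av , bu))
      λ i → [ inj₂ ∘ trade i , inj₁ ∘ trade i ]

    onlyPair : ∀ c t → pos c t ≡ v → c ≡ a ⊎ c ≡ b
    onlyPair c t cv with pair t
    ... | inj₁ (at , _) = inj₁ (collisionFree t (trans cv (≡-sym at)))
    ... | inj₂ (bt , _) = inj₂ (collisionFree t (trans cv (≡-sym bt)))

thirdElement : ∀ {m} (a b : Fin (suc (suc (suc m)))) → ∃ λ c → c ≢ a × c ≢ b
thirdElement zero          zero          = suc zero , (λ ()) , (λ ())
thirdElement zero          (suc zero)    = suc (suc zero) , (λ ()) , (λ ())
thirdElement zero          (suc (suc _)) = suc zero , (λ ()) , (λ ())
thirdElement (suc zero)    zero          = suc (suc zero) , (λ ()) , (λ ())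
thirdElement (suc zero)    (suc _)       = zero , (λ ()) , (λ ())
thirdElement (suc (suc _)) zero          = suc zero , (λ ()) , (λ ())
thirdElement (suc (suc _)) (suc _)       = zero , (λ ()) , (λ ())

proposition3p17 : (n : ℕ) → 3 ≤ n → (G : Graph n) → Connected G →
    (∃ λ (v : Fin n) → degree G v ≡ 1) → ¬ DirectTopfull G
proposition3p17 (suc (suc (suc _))) (s≤s (s≤s (s≤s _))) G _ (v , deg)
                (_ , (_ , _ , F , minDist) , _)
  with u , _ , onlyNeighbour ← degree≡1⇒uniqueNeighbour G v deg
  with a , b , onlyPair ←
         leafVisitedByTwoTracks G F (minDistOne⇒collisionFree G F minDist) {v} onlyNeighbour
  with c , c≢a , c≢b ← thirdElement a b
  with t , ct ← surj (F c) v
  = [ c≢a , c≢b ] (onlyPair c t ct)
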